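{- Let $A$ be an $n\times n$ matrix with entries from a totally ordered set. Let $R_1,\ldots,R_k$ and $C_1,\ldots,C_\ell$ be subsets of $[n]$ with $R_1\cup\cdots\cup R_k=[n]=C_1\cup\cdots\cup C_\ell$. For $i\in[k]$, $j\in[\ell]$ let $A_{R_i,C_j}$ be the submatrix of $A$ formed by the rows with indices in $R_i$ and the columns with indices in $C_j$. Let $A'$ be a $k\times\ell$ matrix whose entry $a'_{i,j}$ is a pseudo-saddlepoint of $A_{R_i,C_j}$ for all $i\in[k]$, $j\in[\ell]$. Then every pseudo-saddlepoint of $A'$ is a pseudo-saddlepoint of $A$.
   Context: For a matrix $M$, a pseudo-saddlepoint is an entry of $M$ with value $v$ such that every row of $M$ contains an entry $\geq v$ and every column of $M$ contains an entry $\leq v$. Here $[n]=\{1,\ldots,n\}$. -}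

module Defs where

open import Level using (Level; _⊔_)
open import Data.Nat using (ℕ)
open import Data.Fin using (Fin)
open import Data.Fin.Subset using (Subset; _∈_)
open import Data.Product using (Σ; ∃; _×_; _,_)
open import Relation.Binary.Bundles using (TotalOrder)

module _ {c ℓ₁ ℓ₂ : Level} (O : TotalOrder c ℓ₁ ℓ₂) where
  open TotalOrder O

  Matrix : {a b : Level} → Set a → Set b → Set (a ⊔ b ⊔ c)
  Matrix I J = I → J → Carrier

  IsPseudoSaddlepoint : {a b : Level} {I : Set a} {J : Set b} →
                        Matrix I J → Carrier → Set (a ⊔ b ⊔ ℓ₁ ⊔ ℓ₂)
  IsPseudoSaddlepoint {I = I} {J} M v =
    (∃ λ (i : I) → ∃ λ (j : J) → M i j ≈ v) ×
    (∀ (i : I) → ∃ λ (j : J) → v ≤ M i j) ×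
    (∀ (j : J) → ∃ λ (i : I) → M i j ≤ v)

  submatrix : {n : ℕ} → Matrix (Fin n) (Fin n) → (R C : Subset n) →
              Matrix (Σ (Fin n) (_∈ R)) (Σ (Fin n) (_∈ C))
  submatrix A R C (r , _) (s , _) = A r s

-- A value v of A′ sits in some block of A, so it is an entry of A.  For a row x of A,
-- pick a row block R i containing x and a column j of A′ with v ≤ A′ i j; the row x of the
-- block A_{R i, C j} has an entry ≥ A′ i j, hence ≥ v.  Columns are symmetric.
module Submission where

open import Defs
open import Level using (Level; _⊔_)
open import Data.Nat using (ℕ)
open import Data.Fin using (Fin)
open import Data.Fin.Subset using (Subset; _∈_)
open import Data.Product using (∃; _,_; proj₁; proj₂)
open import Relation.Binary.Bundles using (TotalOrder)

module _ {c ℓ₁ ℓ₂ : Level} (O : TotalOrder c ℓ₁ ℓ₂) where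
  open TotalOrder O

  HasEntry : {a b : Level} {I : Set a} {J : Set b} → Matrix O I J → Carrier → Set (a ⊔ b ⊔ ℓ₁)
  HasEntry {I = I} {J} M v = ∃ λ (i : I) → ∃ λ (j : J) → M i j ≈ v

  EveryRowReaches : {a b : Level} {I : Set a} {J : Set b} → Matrix O I J → Carrier → Set (a ⊔ b ⊔ ℓ₂)
  EveryRowReaches {I = I} {J} M v = ∀ (i : I) → ∃ λ (j : J) → v ≤ M i j

  EveryColumnReaches : {a b : Level} {I : Set a} {J : Set b} → Matrix O I J → Carrier → Set (a ⊔ b ⊔ ℓ₂)
  EveryColumnReaches {I = I} {J} M v = ∀ (j : J) → ∃ λ (i : I) → M i j ≤ v

  module _ {n k ℓ : ℕ} (A : Matrix O (Fin n) (Fin n))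
           (R : Fin k → Subset n) (C : Fin ℓ → Subset n)
           (A′ : Matrix O (Fin k) (Fin ℓ)) where

    hasEntry-fromBlocks : (∀ i j → HasEntry (submatrix O A (R i) (C j)) (A′ i j)) →
                          ∀ {v} → HasEntry A′ v → HasEntry A v
    hasEntry-fromBlocks blockEntry (i , j , A′ij≈v) with blockEntry i j
    ... | (x , _) , (y , _) , Axy≈A′ij = x , y , Eq.trans Axy≈A′ij A′ij≈v

    everyRowReaches-fromBlocks :
      (∀ x → ∃ λ i → x ∈ R i) →
      (∀ i j → EveryRowReaches (submatrix O A (R i) (C j)) (A′ i j)) →
      ∀ {v} → EveryRowReaches A′ v → EveryRowReaches A v
    everyRowReaches-fromBlocks coverR blockRows rows x with coverR x
    ... | i , x∈Ri with rows i
    ...   | j , v≤A′ij with blockRows i j (x , x∈Ri)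
    ...     | (y , _) , A′ij≤Axy = y , trans v≤A′ij A′ij≤Axy

    everyColumnReaches-fromBlocks :
      (∀ y → ∃ λ j → y ∈ C j) →
      (∀ i j → EveryColumnReaches (submatrix O A (R i) (C j)) (A′ i j)) →
      ∀ {v} → EveryColumnReaches A′ v → EveryColumnReaches A v
    everyColumnReaches-fromBlocks coverC blockColumns columns y with coverC y
    ... | j , y∈Cj with columns j
    ...   | i , A′ij≤v with blockColumns i j (y , y∈Cj)
    ...     | (x , _) , Axy≤A′ij = x , trans Axy≤A′ij A′ij≤v

lemma10 : {c ℓ₁ ℓ₂ : Level} (O : TotalOrder c ℓ₁ ℓ₂) (n k ℓ : ℕ)
          (A : Matrix O (Fin n) (Fin n))
          (R : Fin k → Subset n) (C : Fin ℓ → Subset n) →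
          (∀ (x : Fin n) → ∃ λ (i : Fin k) → x ∈ R i) →
          (∀ (x : Fin n) → ∃ λ (j : Fin ℓ) → x ∈ C j) →
          (A′ : Matrix O (Fin k) (Fin ℓ)) →
          (∀ (i : Fin k) (j : Fin ℓ) →
            IsPseudoSaddlepoint O (submatrix O A (R i) (C j)) (A′ i j)) →
          (v : TotalOrder.Carrier O) → IsPseudoSaddlepoint O A′ v → IsPseudoSaddlepoint O A v
lemma10 O n k ℓ A R C coverR coverC A′ blockSaddle v (entry , rows , columns) =
    hasEntry-fromBlocks O A R C A′ (λ i j → proj₁ (blockSaddle i j)) entry
  , everyRowReaches-fromBlocks O A R C A′ coverR (λ i j → proj₁ (proj₂ (blockSaddle i j))) rows
  , everyColumnReaches-fromBlocks O A R C A′ coverC (λ i j → proj₂ (proj₂ (blockSaddle i j))) columns
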